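{- Let $G$ be a graph, $uv\in E(G)$, and let $S$ be a general position set of $D(G)$. If $|S\cap\{u,v,u',v'\}|\ge 2$, then $|S\cap\{u,v,u',v'\}|=2$.
   Context: All graphs are finite and simple. The double graph $D(G)$ is obtained from the disjoint union of $G$ and a copy $G'$ with $V(G')=\{u': u\in V(G)\}$ by joining each $u\in V(G)$ to all neighbors of $u'$ in $G'$ and each $u'$ to all neighbors of $u$ in $G$; thus $N_{D(G)}(u)=N_{D(G)}(u')$. A set $S$ of vertices of a graph is a general position set if no three vertices of $S$ lie on a common shortest path. -}

module Defs where

open import Data.Nat using (ℕ; zero; suc; _+_; _≤_)
open import Data.Fin using (Fin)
open import Data.Bool using (Bool; true; false)
open import Data.Sum using (_⊎_; inj₁; inj₂)
open import Data.Product using (Σ; ∃; _×_; _,_)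
open import Data.List using (List; []; _∷_)
open import Relation.Nullary using (¬_)
open import Relation.Binary.PropositionalEquality using (_≡_; _≢_)

record Graph (V : Set) : Set₁ where
  field
    Adj   : V → V → Set
    sym   : ∀ {x y} → Adj x y → Adj y x
    irrefl : ∀ {x} → ¬ Adj x x
open Graph public

FinGraph : ℕ → Set₁
FinGraph n = Graph (Fin n)

-- Double graph: vertices inj₁ u  (= u ∈ V(G)) and inj₂ u (= u' ∈ V(G')).
strip : ∀ {V : Set} → V ⊎ V → V
strip (inj₁ x) = x
strip (inj₂ x) = x

Double : ∀ {V : Set} → Graph V → Graph (V ⊎ V)
Double G = record
  { Adj = λ x y → Adj G (strip x) (strip y)
  ; sym = λ a → sym G a
  ; irrefl = λ a → irrefl G a
  }

data Walk {V : Set} (G : Graph V) : V → V → Set where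
  nil  : (x : V) → Walk G x x
  cons : ∀ {x y z} → Adj G x y → Walk G y z → Walk G x z

wlength : ∀ {V} {G : Graph V} {x y} → Walk G x y → ℕ
wlength (nil _) = zero
wlength (cons _ w) = suc (wlength w)

data _∈W_ {V : Set} {G : Graph V} (v : V) : ∀ {x y} → Walk G x y → Set where
  here-nil  : v ∈W nil v
  here-cons : ∀ {y z} {a : Adj G v y} {w : Walk G y z} → v ∈W cons a w
  there     : ∀ {x y z} {a : Adj G x y} {w : Walk G y z} → v ∈W w → v ∈W cons a w

IsShortest : ∀ {V} {G : Graph V} {x y} → Walk G x y → Set
IsShortest {G = G} {x} {y} w = ∀ (w' : Walk G x y) → wlength w ≤ wlength w'

OnCommonShortestPath : ∀ {V} (G : Graph V) → V → V → V → Set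
OnCommonShortestPath {V} G p q r =
  Σ V λ a → Σ V λ b → Σ (Walk G a b) λ w →
    IsShortest w × p ∈W w × q ∈W w × r ∈W w

IsGeneralPosition : ∀ {V} (G : Graph V) → (V → Bool) → Set
IsGeneralPosition {V} G S =
  ∀ (p q r : V) → S p ≡ true → S q ≡ true → S r ≡ true →
    p ≢ q → q ≢ r → p ≢ r → ¬ OnCommonShortestPath G p q r

boolToℕ : Bool → ℕ
boolToℕ true = 1
boolToℕ false = 0

countIn : ∀ {V : Set} → (V → Bool) → List V → ℕ
countIn S [] = zero
countIn S (x ∷ xs) = boolToℕ (S x) + countIn S xs

-- Any three of u, v, u′, v′ contain a twin pair x, x′ together with a common neighbour y of
-- both. Twins are distinct and non-adjacent, so d(x, x′) = 2 and x y x′ is a shortest path: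
-- three of the four vertices are never in general position.
module Submission where

open import Defs
open import Data.Nat using (ℕ; _≤_; s≤s; z≤n)
open import Data.Nat.Properties using (≤-antisym)
open import Data.Fin using (Fin)
open import Data.Bool using (Bool; true; false)
open import Data.Sum using (_⊎_; inj₁; inj₂)
open import Data.List using ([]; _∷_)
open import Data.Product using (_,_)
open import Data.Empty using (⊥; ⊥-elim)
open import Function using (id)
open import Relation.Binary.PropositionalEquality using (_≡_; _≢_; refl)

module _ {V : Set} (G : Graph V) where

  twins-distance≥2 : ∀ {x} (w : Walk (Double G) (inj₁ x) (inj₂ x)) → 2 ≤ wlength w
  twins-distance≥2 (cons x~y (nil _)) = ⊥-elim (irrefl G x~y)
  twins-distance≥2 (cons _ (cons _ _)) = s≤s (s≤s z≤n)

  twins-commonNeighbour-onShortestPath : ∀ {x m} → Adj G x (strip m) →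
    OnCommonShortestPath (Double G) (inj₁ x) m (inj₂ x)
  twins-commonNeighbour-onShortestPath {x} {m} x~m =
    inj₁ x , inj₂ x , path , twins-distance≥2 , here-cons , there here-cons , there (there here-nil)
    where
    path : Walk (Double G) (inj₁ x) (inj₂ x)
    path = cons {y = m} x~m (cons (sym G x~m) (nil (inj₂ x)))

  generalPosition-¬twins-commonNeighbour : (S : V ⊎ V → Bool) → IsGeneralPosition (Double G) S →
    ∀ {x m} → Adj G x (strip m) → S (inj₁ x) ≡ true → S (inj₂ x) ≡ true → S m ≡ true → ⊥
  generalPosition-¬twins-commonNeighbour S gp {x} {m} x~m Sx Sx′ Sm =
    gp (inj₁ x) m (inj₂ x) Sx Sm Sx′ x≢m m≢x′ (λ ())
      (twins-commonNeighbour-onShortestPath x~m)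
    where
    x≢m : inj₁ x ≢ m
    x≢m refl = irrefl G x~m
    m≢x′ : m ≢ inj₂ x
    m≢x′ refl = irrefl G x~m

-- The four Booleans stand for membership of u, v, u′, v′; the hypotheses exclude a twin pair
-- (first and third, or second and fourth) together with any further member.
count≤2-without-twinTriple : (a b c d : Bool) →
  (a ≡ true → c ≡ true → b ≡ true → ⊥) → (a ≡ true → c ≡ true → d ≡ true → ⊥) →
  (b ≡ true → d ≡ true → a ≡ true → ⊥) → (b ≡ true → d ≡ true → c ≡ true → ⊥) →
  countIn id (a ∷ b ∷ c ∷ d ∷ []) ≤ 2
count≤2-without-twinTriple true  true  true  _     acb _   _   _   = ⊥-elim (acb refl refl refl)
count≤2-without-twinTriple true  true  false true  _   _   bda _   = ⊥-elim (bda refl refl refl)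
count≤2-without-twinTriple true  false true  true  _   acd _   _   = ⊥-elim (acd refl refl refl)
count≤2-without-twinTriple false true  true  true  _   _   _   bdc = ⊥-elim (bdc refl refl refl)
count≤2-without-twinTriple true  true  false false _   _   _   _   = s≤s (s≤s z≤n)
count≤2-without-twinTriple true  false true  false _   _   _   _   = s≤s (s≤s z≤n)
count≤2-without-twinTriple true  false false true  _   _   _   _   = s≤s (s≤s z≤n)
count≤2-without-twinTriple false true  true  false _   _   _   _   = s≤s (s≤s z≤n)
count≤2-without-twinTriple false true  false true  _   _   _   _   = s≤s (s≤s z≤n)
count≤2-without-twinTriple false false true  true  _   _   _   _   = s≤s (s≤s z≤n)
count≤2-without-twinTriple true  false false false _   _   _   _   = s≤s z≤n
count≤2-without-twinTriple false true  false false _   _   _   _   = s≤s z≤n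
count≤2-without-twinTriple false false true  false _   _   _   _   = s≤s z≤n
count≤2-without-twinTriple false false false true  _   _   _   _   = s≤s z≤n
count≤2-without-twinTriple false false false false _   _   _   _   = z≤n

lemma4p1 : (n : ℕ) (G : FinGraph n) (u v : Fin n) → Adj G u v →
    (S : Fin n ⊎ Fin n → Bool) → IsGeneralPosition (Double G) S →
    2 ≤ countIn S (inj₁ u ∷ inj₁ v ∷ inj₂ u ∷ inj₂ v ∷ []) →
    countIn S (inj₁ u ∷ inj₁ v ∷ inj₂ u ∷ inj₂ v ∷ []) ≡ 2
lemma4p1 n G u v u~v S gp 2≤count = ≤-antisym count≤2 2≤count
  where
  no-twinTriple : ∀ {x m} → Adj G x (strip m) →
    S (inj₁ x) ≡ true → S (inj₂ x) ≡ true → S m ≡ true → ⊥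
  no-twinTriple = generalPosition-¬twins-commonNeighbour G S gp
  count≤2 : countIn S (inj₁ u ∷ inj₁ v ∷ inj₂ u ∷ inj₂ v ∷ []) ≤ 2
  count≤2 = count≤2-without-twinTriple (S (inj₁ u)) (S (inj₁ v)) (S (inj₂ u)) (S (inj₂ v))
    (no-twinTriple {m = inj₁ v} u~v) (no-twinTriple {m = inj₂ v} u~v)
    (no-twinTriple {m = inj₁ u} (sym G u~v)) (no-twinTriple {m = inj₂ u} (sym G u~v))
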